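{- Let $\Pi X.\, s\ [\exists\vec{x}.\,\varphi]$ be a satisfiable existentially constrained term and write $\sim$ for $\sim_{\mathcal{P}os_{X\cup\mathcal{V}al}(s)}$. Then: (1) for each $p\in\mathcal{P}os_{\mathcal{V}al!}(s)$ there is a unique value $v\in\mathcal{V}al$ with $\vDash_{\mathcal{M}}(\exists\vec{x}.\varphi)\Rightarrow(s|_p=v)$; (2) for all $p,q\in\mathcal{P}os_{X\cup\mathcal{V}al}(s)$, if $p\in\mathcal{P}os_{\mathcal{V}al!}(s)$ and $p\sim q$, then $q\in\mathcal{P}os_{\mathcal{V}al!}(s)$; (3) for all $p,q\in\mathcal{P}os_{X\cup\mathcal{V}al}(s)$ and $v,v'\in\mathcal{V}al$, if $p\sim q$, $\vDash_{\mathcal{M}}(\exists\vec{x}.\varphi)\Rightarrow(s|_p=v)$ and $\vDash_{\mathcal{M}}(\exists\vec{x}.\varphi)\Rightarrow(s|_q=v')$, then $v=v'$.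
   Context: Fix a many-sorted signature whose sorts are partitioned into theory sorts and term sorts and whose function symbols are partitioned into theory symbols (all argument and result sorts are theory sorts) and term symbols; terms are built from these symbols and sorted variables. A fixed model $\mathcal{M}$ interprets theory sorts and theory symbols; the sort Bool is interpreted as $\{\mathsf{true},\mathsf{false}\}$, equality is available as a theory symbol, and every element of the interpretation of every theory sort is a constant symbol of the signature, called a value; $\mathcal{V}al$ is the set of values. A logical constraint is a Bool-sorted term built from theory symbols and variables. A valuation $\rho$ maps theory-sorted variables to elements of the interpretations of their sorts; $\vDash_{\mathcal{M},\rho}\varphi$ means $\varphi$ evaluates to true under $\rho$. $\mathcal{V}ar(\cdot)$ denotes the set of variables occurring in an expression. For a term $s$: $s|_p$ is the subterm at position $p$, $s(p)$ the symbol at $p$, and $\mathcal{P}os_U(s)$ the set of positions $p$ with $s(p)\in U$. An existential constraint $\exists\vec{x}.\,\varphi$ is a pair of a sequence of variables $\vec{x}$ and a logical constraint $\varphi$ with $\{\vec{x}\}\subseteq\mathcal{V}ar(\varphi)$; its free variables are $\mathcal{FV}ar(\exists\vec{x}.\varphi)=\mathcal{V}ar(\varphi)\setminus\{\vec{x}\}$. $\vDash_{\mathcal{M},\rho}\exists\vec{x}.\varphi$ iff there are values $\vec{v}$ with $\vDash_{\mathcal{M},\rho}\varphi\{\vec{x}\mapsto\vec{v}\}$; it is satisfiable if this holds for some $\rho$. $\vDash_{\mathcal{M}} A\Rightarrow e$, for an existential constraint $A$ and an equation $e$ between theory terms, means every valuation $\rho$ with $\vDash_{\mathcal{M},\rho}A$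 satisfies $\vDash_{\mathcal{M},\rho}e$. An existentially constrained term $\Pi X.\, s\ [\exists\vec{x}.\,\varphi]$ is a triple of a set $X$ of variables, a term $s$ and an existential constraint with $\mathcal{FV}ar(\exists\vec{x}.\varphi)\subseteq X\subseteq\mathcal{V}ar(s)$ and $\{\vec{x}\}\cap\mathcal{V}ar(s)=\emptyset$; it is satisfiable if its constraint is. The relation $\sim_{\mathcal{P}os_{X\cup\mathcal{V}al}(s)}$ on $\mathcal{P}os_{X\cup\mathcal{V}al}(s)$ is defined by: $p\sim q$ iff $\vDash_{\mathcal{M}}(\exists\vec{x}.\varphi)\Rightarrow(s|_p=s|_q)$. $\mathcal{P}os_{\mathcal{V}al!}(s)$ is the set of $p\in\mathcal{P}os_{X\cup\mathcal{V}al}(s)$ for which there exists $v\in\mathcal{V}al$ with $\vDash_{\mathcal{M}}(\exists\vec{x}.\varphi)\Rightarrow(s|_p=v)$. -}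

module Defs where

open import Data.Bool using (Bool; true; false; T)
open import Data.Nat using (ℕ; zero; suc)
open import Data.List using (List; []; _∷_; _++_)
open import Data.List.Relation.Unary.All using (All; []; _∷_)
open import Data.List.Membership.Propositional using (_∈_; _∉_)
import Data.List.Membership.DecPropositional as DecMem
open import Data.Maybe using (Maybe; just; nothing; _>>=_)
import Data.Maybe as Maybe
open import Data.Product using (Σ; ∃; _×_; _,_)
open import Data.Unit using (⊤; tt)
open import Data.Empty using (⊥)
open import Relation.Nullary using (Dec; yes; no)
open import Relation.Nullary.Decidable using (T?)
open import Relation.Binary.PropositionalEquality using (_≡_; subst)
open import Relation.Binary.Definitions using (DecidableEquality)

record Setting : Set₁ where
  field
    Sort  : Set
    isTh  : Sort → Bool
    𝔹     : Sort
    𝔹-th  : T (isTh 𝔹)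
    -- (non-value) function symbols; thF f = true iff f is a theory symbol
    Fun   : Set
    thF   : Fun → Bool
    ar    : Fun → List Sort
    res   : Fun → Sort
    th-ar  : (f : Fun) → T (thF f) → All (λ σ → T (isTh σ)) (ar f)
    th-res : (f : Fun) → T (thF f) → T (isTh (res f))
    Var   : Set
    vsort : Var → Sort
    _≟V_  : DecidableEquality Var
    ⟦_⟧   : Sort → Set
    ⟦𝔹⟧   : ⟦ 𝔹 ⟧ ≡ Bool
    ifun  : (f : Fun) → T (thF f) → All ⟦_⟧ (ar f) → ⟦ res f ⟧

module Theory (S : Setting) where
  open Setting S

  -- Besides the symbols in Fun, every element c of the
  -- interpretation of a theory sort σ is a constant symbol  val σ h c
  -- (a value); values are theory symbols interpreted as themselves.
  mutual
    data Term : Sort → Set where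
      var : (x : Var) → Term (vsort x)
      val : (σ : Sort) → T (isTh σ) → ⟦ σ ⟧ → Term σ
      app : (f : Fun) → Args (ar f) → Term (res f)

    data Args : List Sort → Set where
      []  : Args []
      _∷_ : {σ : Sort} {σs : List Sort} → Term σ → Args σs → Args (σ ∷ σs)

  STerm : Set
  STerm = Σ Sort Term

  Value : Set
  Value = Σ Sort (λ σ → T (isTh σ) × ⟦ σ ⟧)

  valTerm : Value → STerm
  valTerm (σ , h , c) = σ , val σ h c

  mutual
    vars : {σ : Sort} → Term σ → List Var
    vars (var x)     = x ∷ []
    vars (val _ _ _) = []
    vars (app f ts)  = varsA ts

    varsA : {σs : List Sort} → Args σs → List Var
    varsA []       = []
    varsA (t ∷ ts) = vars t ++ varsA ts

  -- Positions are lists of natural numbers; argument indices start at 1.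
  -- s ∣ p  is  s|_p  (nothing if p is not a position of s).
  Position : Set
  Position = List ℕ

  mutual
    _∣_ : {σ : Sort} → Term σ → Position → Maybe STerm
    t ∣ []                 = just (_ , t)
    var x ∣ (i ∷ p)        = nothing
    val _ _ _ ∣ (i ∷ p)    = nothing
    app f ts ∣ (i ∷ p)     = argAt ts i p

    argAt : {σs : List Sort} → Args σs → ℕ → Position → Maybe STerm
    argAt ts zero p                 = nothing
    argAt [] (suc i) p              = nothing
    argAt (t ∷ ts) (suc zero) p     = t ∣ p
    argAt (t ∷ ts) (suc (suc i)) p  = argAt ts (suc i) p

  mutual
    ThTerm : {σ : Sort} → Term σ → Set
    ThTerm (var x)     = T (isTh (vsort x))
    ThTerm (val _ _ _) = ⊤
    ThTerm (app f ts)  = T (thF f) × ThArgs ts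

    ThArgs : {σs : List Sort} → Args σs → Set
    ThArgs []       = ⊤
    ThArgs (t ∷ ts) = ThTerm t × ThArgs ts

  LogicalConstraint : Term 𝔹 → Set
  LogicalConstraint φ = ThTerm φ

  Valuation : Set
  Valuation = (x : Var) → T (isTh (vsort x)) → ⟦ vsort x ⟧

  byTh : {A : Set} (b : Bool) → (T b → A) → Maybe A
  byTh true  k = just (k tt)
  byTh false k = nothing

  -- evaluation of theory terms under ρ (nothing on non-theory terms)
  mutual
    eval : Valuation → {σ : Sort} → Term σ → Maybe ⟦ σ ⟧
    eval ρ (var x)     = byTh (isTh (vsort x)) (ρ x)
    eval ρ (val _ _ c) = just c
    eval ρ (app f ts)  =
      byTh (thF f) (λ h → Maybe.map (ifun f h) (evalA ρ ts)) >>= λ r → r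

    evalA : Valuation → {σs : List Sort} → Args σs → Maybe (All ⟦_⟧ σs)
    evalA ρ []       = just []
    evalA ρ (t ∷ ts) = eval ρ t >>= λ a → evalA ρ ts >>= λ as → just (a ∷ as)

  _⊨_ : Valuation → Term 𝔹 → Set
  ρ ⊨ φ = Maybe.map (subst (λ A → A) ⟦𝔹⟧) (eval ρ φ) ≡ just true

  -- ⊨_{M,ρ} (t = u) for an equation between (theory) terms; both sides
  -- are looked up as possibly-undefined subterms
  evalS : Valuation → Maybe STerm → Maybe (Σ Sort ⟦_⟧)
  evalS ρ m = m >>= λ { (σ , t) → Maybe.map (λ a → σ , a) (eval ρ t) }

  EqHolds : Valuation → Maybe STerm → Maybe STerm → Set
  EqHolds ρ t u = ∃ λ a → evalS ρ t ≡ just a × evalS ρ u ≡ just a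

  -- φ{x⃗ ↦ v⃗}: the value assignment is given by θ on the variables of x⃗
  module _ (θ : Valuation) (xs : List Var) where
    open DecMem _≟V_ using (_∈?_)

    instVar : (x : Var) → Dec (x ∈ xs) → Dec (T (isTh (vsort x))) → Term (vsort x)
    instVar x (yes _) (yes h) = val (vsort x) h (θ x h)
    instVar x _       _       = var x

    mutual
      inst : {σ : Sort} → Term σ → Term σ
      inst (var x)     = instVar x (x ∈? xs) (T? (isTh (vsort x)))
      inst (val σ h c) = val σ h c
      inst (app f ts)  = app f (instA ts)

      instA : {σs : List Sort} → Args σs → Args σs
      instA []       = []
      instA (t ∷ ts) = inst t ∷ instA ts

  record ExConstraint : Set where
    field
      xs      : List Var
      φ       : Term 𝔹
      logical : LogicalConstraint φ
      xs⊆     : (x : Var) → x ∈ xs → x ∈ vars φ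

  _∈FV_ : Var → ExConstraint → Set
  x ∈FV A = x ∈ vars (ExConstraint.φ A) × x ∉ ExConstraint.xs A

  _⊨∃_ : Valuation → ExConstraint → Set
  ρ ⊨∃ A = ∃ λ (θ : Valuation) → ρ ⊨ inst θ (ExConstraint.xs A) (ExConstraint.φ A)

  SatisfiableEC : ExConstraint → Set
  SatisfiableEC A = ∃ λ ρ → ρ ⊨∃ A

  ⊨_⇒_≐_ : ExConstraint → Maybe STerm → Maybe STerm → Set
  ⊨ A ⇒ t ≐ u = (ρ : Valuation) → ρ ⊨∃ A → EqHolds ρ t u

  record ECTerm : Set where
    field
      X    : List Var
      τ    : Sort
      s    : Term τ
      A    : ExConstraint
      FV⊆X : (x : Var) → x ∈FV A → x ∈ X
      X⊆s  : (x : Var) → x ∈ X → x ∈ vars s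
      xs#s : (x : Var) → x ∈ ExConstraint.xs A → x ∉ vars s

  module _ (E : ECTerm) where
    open ECTerm E

    Satisfiable : Set
    Satisfiable = SatisfiableEC A

    XorVal : STerm → Set
    XorVal (_ , var x)     = x ∈ X
    XorVal (_ , val _ _ _) = ⊤
    XorVal (_ , app _ _)   = ⊥

    InPosXVal : Position → Set
    InPosXVal p = ∃ λ t → s ∣ p ≡ just t × XorVal t

    ValAt : Position → Value → Set
    ValAt p v = ⊨ A ⇒ (s ∣ p) ≐ just (valTerm v)

    _∼_ : Position → Position → Set
    p ∼ q = ⊨ A ⇒ (s ∣ p) ≐ (s ∣ q)

    InPosVal! : Position → Set
    InPosVal! p = InPosXVal p × ∃ λ v → ValAt p v

{-# OPTIONS --safe #-}
module Submission where

-- Entailment of equations by an existential constraint is symmetric and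
-- transitive because evaluation is a function, and a value evaluates to
-- itself, so two values entailed equal to the same subterm coincide as soon
-- as one valuation satisfies the constraint.

open import Defs
open import Data.Bool.Properties using (T-irrelevant)
open import Data.Maybe using (Maybe; just)
open import Data.Product using (Σ; _×_; _,_)
open import Relation.Binary.PropositionalEquality using (_≡_; refl; sym; trans; cong)

-- The relations of Defs unfold to Σ-types over evaluation, from which unification
-- cannot recover their indices, so the lemmas below take them explicitly.
module Entailment (S : Setting) where
  open Setting S
  open Theory S

  module _ (ρ : Valuation) where

    EqHolds-sym : (t u : Maybe STerm) → EqHolds ρ t u → EqHolds ρ u t
    EqHolds-sym _ _ (a , t≡a , u≡a) = a , u≡a , t≡a

    EqHolds-trans : (t u w : Maybe STerm) →
                    EqHolds ρ t u → EqHolds ρ u w → EqHolds ρ t w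
    EqHolds-trans _ _ _ (a , t≡a , u≡a) (b , u≡b , w≡b) =
      a , t≡a , trans w≡b (sym (trans (sym u≡a) u≡b))

    EqHolds-valTerm-injective : (v v′ : Value) →
      EqHolds ρ (just (valTerm v)) (just (valTerm v′)) → v ≡ v′
    EqHolds-valTerm-injective (σ , h , c) (.σ , h′ , .c) (_ , refl , refl) =
      cong (λ h″ → σ , h″ , c) (T-irrelevant h h′)

  module _ (A : ExConstraint) where

    ⇒-sym : (t u : Maybe STerm) → ⊨ A ⇒ t ≐ u → ⊨ A ⇒ u ≐ t
    ⇒-sym t u t≐u ρ ρ⊨A = EqHolds-sym ρ t u (t≐u ρ ρ⊨A)

    ⇒-trans : (t u w : Maybe STerm) → ⊨ A ⇒ t ≐ u → ⊨ A ⇒ u ≐ w → ⊨ A ⇒ t ≐ w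
    ⇒-trans t u w t≐u u≐w ρ ρ⊨A = EqHolds-trans ρ t u w (t≐u ρ ρ⊨A) (u≐w ρ ρ⊨A)

    ⇒-value-unique : SatisfiableEC A → (t : Maybe STerm) (v v′ : Value) →
      ⊨ A ⇒ t ≐ just (valTerm v) → ⊨ A ⇒ t ≐ just (valTerm v′) → v ≡ v′
    ⇒-value-unique (ρ , ρ⊨A) t v v′ t≐v t≐v′ =
      EqHolds-valTerm-injective ρ v v′
        (EqHolds-trans ρ (just (valTerm v)) t (just (valTerm v′))
          (EqHolds-sym ρ t (just (valTerm v)) (t≐v ρ ρ⊨A)) (t≐v′ ρ ρ⊨A))

  module _ (E : ECTerm) where
    open ECTerm E

    ∼-sym : (p q : Position) → _∼_ E p q → _∼_ E q p
    ∼-sym p q = ⇒-sym A (s ∣ p) (s ∣ q)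

    ValAt-resp-∼ : (p q : Position) (v : Value) → _∼_ E p q → ValAt E q v → ValAt E p v
    ValAt-resp-∼ p q v = ⇒-trans A (s ∣ p) (s ∣ q) (just (valTerm v))

    ValAt-unique : Satisfiable E → (p : Position) (v v′ : Value) →
                   ValAt E p v → ValAt E p v′ → v ≡ v′
    ValAt-unique sat p = ⇒-value-unique A sat (s ∣ p)

lemma12 : (S : Setting) → let open Theory S in
    (E : ECTerm) → Satisfiable E →
      ((p : Position) → InPosVal! E p →
         Σ Value (λ v → ValAt E p v × ((v′ : Value) → ValAt E p v′ → v ≡ v′)))
    × ((p q : Position) → InPosXVal E p → InPosXVal E q →
         InPosVal! E p → _∼_ E p q → InPosVal! E q)
    × ((p q : Position) (v v′ : Value) → InPosXVal E p → InPosXVal E q →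
         _∼_ E p q → ValAt E p v → ValAt E q v′ → v ≡ v′)
lemma12 S E sat =
    (λ p (_ , v , p≐v) → v , p≐v , λ v′ → ValAt-unique E sat p v v′ p≐v)
  , (λ p q _ q-XVal (_ , v , p≐v) p∼q →
       q-XVal , v , ValAt-resp-∼ E q p v (∼-sym E p q p∼q) p≐v)
  , (λ p q v v′ _ _ p∼q p≐v q≐v′ →
       ValAt-unique E sat p v v′ p≐v (ValAt-resp-∼ E p q v′ p∼q q≐v′))
  where open Entailment S
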